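{- Let $n\ge 2$, $i\in\{1,\dots,n\}$ and $j\in\{n+1,\dots,3n\}$. Let $P$ be the $2n\times 2n$ real symmetric matrix whose diagonal entry in position $(2i,2i)$ is $-3$ and all other diagonal entries are $-2$, whose entries in positions $(k,k+1)$ and $(k+1,k)$ are $1$ for $1\le k\le 2n-1$, whose entries in positions $(1,2n)$ and $(2n,1)$ are $1$, and whose other entries are $0$. Let $W_3$ be the $(2n-1)\times(2n-1)$ matrix obtained from $P$ by deleting its $(j-n)$-th row and $(j-n)$-th column. Then \[\det(W_3)=\begin{cases}(j-n)^2-4(j-n)i+4i^2-2n-2n(j-n-2i), & \text{if } 2i\le j-n,\\ (j-n)^2-4(j-n)i+4i^2-2n+2n(j-n-2i), & \text{if } 2i> j-n.\end{cases}\] -}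

module Defs where

open import Data.Bool using (Bool; true; false; if_then_else_; _∨_; _∧_)
open import Data.Nat as ℕ using (ℕ; zero; suc; _∸_; _<ᵇ_; _≡ᵇ_)
open import Data.Fin using (Fin; toℕ; punchIn)
import Data.Fin as Fin
open import Data.Integer as ℤ using (ℤ; +_; -_; _*_; _+_)

Matrix : ℕ → Set
Matrix N = Fin N → Fin N → ℤ

sumFin : (N : ℕ) → (Fin N → ℤ) → ℤ
sumFin zero    f = + 0
sumFin (suc N) f = f Fin.zero + sumFin N (λ k → f (Fin.suc k))

sign : ℕ → ℤ
sign zero          = + 1
sign (suc zero)    = - (+ 1)
sign (suc (suc k)) = sign k

minor0 : {N : ℕ} → Matrix (suc N) → Fin (suc N) → Matrix N
minor0 M k r c = M (Fin.suc r) (punchIn k c)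

det : (N : ℕ) → Matrix N → ℤ
det zero    M = + 1
det (suc N) M = sumFin (suc N) (λ k → sign (toℕ k) * (M Fin.zero k * det N (minor0 M k)))

-- Entry (a,b) (1-based indices a,b ∈ {1,…,2n}) of the 2n×2n matrix P
-- with parameter i: diagonal −3 at (2i,2i), −2 elsewhere on the diagonal,
-- 1 on the sub/superdiagonal, 1 at (1,2n) and (2n,1), 0 otherwise.
Pentry : (n i : ℕ) → ℕ → ℕ → ℤ
Pentry n i a b =
  if a ≡ᵇ b
  then (if a ≡ᵇ (2 ℕ.* i) then - (+ 3) else - (+ 2))
  else (if (suc a ≡ᵇ b) ∨ (suc b ≡ᵇ a)
            ∨ ((a ≡ᵇ 1) ∧ (b ≡ᵇ 2 ℕ.* n))
            ∨ ((a ≡ᵇ 2 ℕ.* n) ∧ (b ≡ᵇ 1))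
        then + 1 else + 0)

P : (n i : ℕ) → Matrix (2 ℕ.* n)
P n i r c = Pentry n i (suc (toℕ r)) (suc (toℕ c))

-- 1-based index (in {1,…,2n}) of the r-th row/column (0-based r) of the
-- matrix obtained by deleting the m-th row and column (m 1-based).
skip : ℕ → ℕ → ℕ
skip m r = if suc r <ᵇ m then suc r else suc (suc r)

W3 : (n i j : ℕ) → Matrix (2 ℕ.* n ∸ 1)
W3 n i j r c = Pentry n i (skip (j ∸ n) (toℕ r)) (skip (j ∸ n) (toℕ c))

{-# OPTIONS --safe #-}
-- W₃ is the principal submatrix of the cyclic tridiagonal matrix P obtained by
-- deleting the vertex m = j − n of the cycle 1, …, 2n.  A simultaneous cyclic
-- rotation of rows and columns does not change a determinant (moving a row and a
-- column from the front to the back costs the same sign twice), and it lists the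
-- remaining vertices as the path m+1, …, 2n, 1, …, m−1.  So W₃ becomes tridiagonal
-- with unit off-diagonal entries, and its determinant is the continuant of its
-- diagonal: −2 everywhere except −3 at the vertex 2i, which sits at position
-- t = |m − 2i| or 2n − t of the path (nowhere if t = 0).  That continuant of
-- length 2n − 1 is −(2n + t(2n − t)) = t² − 2n − 2nt.
module Submission where

open import Defs
open import Data.Nat using (ℕ; _≤_; _∸_)
import Data.Nat as ℕ
open import Data.Integer using (ℤ; +_; _+_; _-_; _*_)
open import Relation.Binary.PropositionalEquality using (_≡_)
open import Relation.Nullary using (¬_)
open import Data.Product using (_×_)

open import Data.Nat using (zero; suc; _<_; s≤s; z≤n; _≡ᵇ_)
open import Data.Bool using (true; false; _∧_)
import Data.Nat.Properties as ℕP
open import Data.Integer using (-_)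
import Data.Integer.Properties as ℤP
open import Data.Integer.Tactic.RingSolver using (solve-∀)
open import Data.Fin using (Fin; toℕ; punchIn)
import Data.Fin as Fin using (zero; suc)
open import Data.List using (List; []; _∷_; [_]; _++_; length; map; replicate; tabulate)
import Data.List.Properties as ListP
open import Data.List.Properties using (tabulate-cong)
open import Data.List.Relation.Unary.All as All using (All; []; _∷_)
open import Data.List.Relation.Unary.All.Properties using (++⁺)
open import Data.Product using (_,_; proj₁; proj₂; swap)
open import Data.Sum using (_⊎_; inj₁; inj₂)
open import Data.Empty using (⊥-elim)
open import Function using (_∘_)
open import Relation.Nullary using (yes; no)
open import Relation.Nullary.Decidable using (dec-true; dec-false)
open import Relation.Binary.PropositionalEquality
  using (_≢_; refl; sym; trans; cong; cong₂; module ≡-Reasoning)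

sign-suc : ∀ k → sign (suc k) ≡ - sign k
sign-suc zero          = refl
sign-suc (suc zero)    = refl
sign-suc (suc (suc k)) = sign-suc k

sumFin-cong : ∀ N {f h : Fin N → ℤ} → (∀ k → f k ≡ h k) → sumFin N f ≡ sumFin N h
sumFin-cong zero    eq = refl
sumFin-cong (suc N) eq = cong₂ _+_ (eq Fin.zero) (sumFin-cong N (eq ∘ Fin.suc))

sumFin-neg : ∀ N (f : Fin N → ℤ) → sumFin N (λ k → - f k) ≡ - sumFin N f
sumFin-neg zero    f = refl
sumFin-neg (suc N) f =
  trans (cong (λ t → - f Fin.zero + t) (sumFin-neg N (f ∘ Fin.suc)))
        (sym (ℤP.neg-distrib-+ (f Fin.zero) (sumFin N (f ∘ Fin.suc))))

continuant : List ℤ → ℤ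
continuant []           = + 1
continuant (u ∷ [])     = u
continuant (u ∷ v ∷ us) = u * continuant (v ∷ us) - continuant us

continuant-negate : ∀ us → continuant us ≡ sign (length us) * continuant (map -_ us)
continuant-negate []           = refl
continuant-negate (u ∷ [])     = identity u
  where
  identity : ∀ u → u ≡ - + 1 * - u
  identity = solve-∀
continuant-negate (u ∷ v ∷ us) = begin
  u * continuant (v ∷ us) - continuant us
    ≡⟨ cong₂ (λ x y → u * x - y) (continuant-negate (v ∷ us)) (continuant-negate us) ⟩
  u * (sign (suc (length us)) * A) - s * B
    ≡⟨ cong (λ t → u * (t * A) - s * B) (sign-suc (length us)) ⟩
  u * (- s * A) - s * B
    ≡⟨ identity u s A B ⟩
  s * (- u * A - B) ∎
  where
  open ≡-Reasoning
  s A B : ℤ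
  s = sign (length us)
  A = continuant (map -_ (v ∷ us))
  B = continuant (map -_ us)
  identity : ∀ u s a b → u * (- s * a) - s * b ≡ s * (- u * a - b)
  identity = solve-∀

continuant-twos : ∀ L → continuant (replicate L (+ 2)) ≡ + suc L
continuant-twos zero          = refl
continuant-twos (suc zero)    = refl
continuant-twos (suc (suc L)) =
  trans (cong₂ (λ x y → + 2 * x - y) (continuant-twos (suc L)) (continuant-twos L)) (identity (+ L))
  where
  identity : ∀ l → + 2 * (+ 2 + l) - (+ 1 + l) ≡ + 3 + l
  identity = solve-∀

continuant-defect : ∀ x y →
  continuant (replicate x (+ 2) ++ + 3 ∷ replicate y (+ 2)) ≡ + suc (suc (x ℕ.+ y)) + + suc x * + suc y
continuant-defect zero zero          = refl
continuant-defect zero (suc y)       =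
  trans (cong₂ (λ a b → + 3 * a - b) (continuant-twos (suc y)) (continuant-twos y)) (identity (+ y))
  where
  identity : ∀ l → + 3 * (+ 2 + l) - (+ 1 + l) ≡ + 2 + (+ 1 + l) + + 1 * (+ 2 + l)
  identity = solve-∀
continuant-defect (suc zero) y       =
  trans (cong₂ (λ a b → + 2 * a - b) (continuant-defect zero y) (continuant-twos y)) (identity (+ y))
  where
  identity : ∀ l → + 2 * (+ 2 + l + + 1 * (+ 1 + l)) - (+ 1 + l) ≡ + 3 + l + + 2 * (+ 1 + l)
  identity = solve-∀
continuant-defect (suc (suc x)) y    =
  trans (cong₂ (λ a b → + 2 * a - b) (continuant-defect (suc x) y) (continuant-defect x y))
        (identity (+ x) (+ y))
  where
  identity : ∀ x y → + 2 * (+ 3 + (x + y) + (+ 2 + x) * (+ 1 + y)) - (+ 2 + (x + y) + (+ 1 + x) * (+ 1 + y))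
                     ≡ + 4 + (x + y) + (+ 3 + x) * (+ 1 + y)
  identity = solve-∀

module Minors (g : ℕ → ℕ → ℤ) where

  -- Laplace expansion along row r over the columns C, where the minor belonging
  -- to the k-th column is D applied to C without its k-th entry.
  expand : (List ℕ → ℤ) → ℕ → List ℕ → ℤ
  expand D r []      = + 0
  expand D r (c ∷ C) = g r c * D C - expand (λ C′ → D (c ∷ C′)) r C

  -- The determinant of the submatrix of g with rows R and columns C, in that
  -- order; it is junk unless length R ≡ length C.
  subdet : List ℕ → List ℕ → ℤ
  subdet []      C = + 1
  subdet (r ∷ R) C = expand (subdet R) r C

  expand-tabulate : ∀ N D r (κ : Fin (suc N) → ℕ) →
    expand D r (tabulate κ) ≡
    sumFin (suc N) (λ k → sign (toℕ k) * (g r (κ k) * D (tabulate (κ ∘ punchIn k))))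
  expand-tabulate zero    D r κ = identity (g r (κ Fin.zero) * D [])
    where
    identity : ∀ x → x - + 0 ≡ + 1 * x + + 0
    identity = solve-∀
  expand-tabulate (suc N) D r κ = begin
    g r (κ Fin.zero) * D (tabulate (κ ∘ Fin.suc)) - expand (D ∘ (κ Fin.zero ∷_)) r (tabulate (κ ∘ Fin.suc))
      ≡⟨ cong (λ t → g r (κ Fin.zero) * D (tabulate (κ ∘ Fin.suc)) - t)
              (expand-tabulate N (D ∘ (κ Fin.zero ∷_)) r (κ ∘ Fin.suc)) ⟩
    g r (κ Fin.zero) * D (tabulate (κ ∘ Fin.suc)) - sumFin (suc N) later
      ≡⟨ cong₂ _+_ (sym (ℤP.*-identityˡ (g r (κ Fin.zero) * D (tabulate (κ ∘ Fin.suc)))))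
                   (sym (sumFin-neg (suc N) later)) ⟩
    + 1 * (g r (κ Fin.zero) * D (tabulate (κ ∘ Fin.suc))) + sumFin (suc N) (λ k → - later k)
      ≡⟨ cong (λ t → + 1 * (g r (κ Fin.zero) * D (tabulate (κ ∘ Fin.suc))) + t)
              (sumFin-cong (suc N) (λ k → trans (ℤP.neg-distribˡ-* (sign (toℕ k)) (term k))
                                                (cong (_* term k) (sym (sign-suc (toℕ k)))))) ⟩
    sumFin (suc (suc N)) (λ k → sign (toℕ k) * (g r (κ k) * D (tabulate (κ ∘ punchIn k)))) ∎
    where
    open ≡-Reasoning
    term later : Fin (suc N) → ℤ
    term k  = g r (κ (Fin.suc k)) * D (κ Fin.zero ∷ tabulate (κ ∘ Fin.suc ∘ punchIn k))
    later k = sign (toℕ k) * term k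

  det-tabulate : ∀ N (ρ κ : Fin N → ℕ) → det N (λ a b → g (ρ a) (κ b)) ≡ subdet (tabulate ρ) (tabulate κ)
  det-tabulate zero    ρ κ = refl
  det-tabulate (suc N) ρ κ =
    trans (sumFin-cong (suc N) (λ k →
             cong (λ t → sign (toℕ k) * (g (ρ Fin.zero) (κ k) * t))
                  (det-tabulate N (ρ ∘ Fin.suc) (κ ∘ punchIn k))))
          (sym (expand-tabulate N (subdet (tabulate (ρ ∘ Fin.suc))) (ρ Fin.zero) κ))

  expand-cong : ∀ {D E} r C → (∀ C′ → suc (length C′) ≡ length C → D C′ ≡ E C′) →
                expand D r C ≡ expand E r C
  expand-cong r []      eq = refl
  expand-cong r (c ∷ C) eq =
    cong₂ _-_ (cong (g r c *_) (eq C refl)) (expand-cong r C (λ C′ e → eq (c ∷ C′) (cong suc e)))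

  expand-zero-row : ∀ {D} r C → All (λ c → g r c ≡ + 0) C → expand D r C ≡ + 0
  expand-zero-row r []      []       = refl
  expand-zero-row {D} r (c ∷ C) (z ∷ zs) =
    cong₂ (λ a b → a * D C - b) z (expand-zero-row r C zs)

  expand-zero-minors : ∀ {D} r C → (∀ C′ → suc (length C′) ≡ length C → D C′ ≡ + 0) →
                       expand D r C ≡ + 0
  expand-zero-minors r []      z = refl
  expand-zero-minors r (c ∷ C) z =
    trans (cong₂ (λ a b → g r c * a - b) (z C refl) (expand-zero-minors r C (λ C′ e → z (c ∷ C′) (cong suc e))))
          (trans (ℤP.+-identityʳ _) (ℤP.*-zeroʳ (g r c)))

  expand-scale : ∀ s D r C → expand (λ C′ → s * D C′) r C ≡ s * expand D r C
  expand-scale s D r []      = sym (ℤP.*-zeroʳ s)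
  expand-scale s D r (c ∷ C) =
    trans (cong (λ t → g r c * (s * D C) - t) (expand-scale s (λ C′ → D (c ∷ C′)) r C))
          (identity (g r c) s (D C) _)
    where
    identity : ∀ x s d e → x * (s * d) - s * e ≡ s * (x * d - e)
    identity = solve-∀

  expand-linear : ∀ a D E r C →
    expand (λ C′ → a * D C′ - E C′) r C ≡ a * expand D r C - expand E r C
  expand-linear a D E r []      = sym (trans (ℤP.+-identityʳ _) (ℤP.*-zeroʳ a))
  expand-linear a D E r (c ∷ C) =
    trans (cong (λ t → g r c * (a * D C - E C) - t)
                (expand-linear a (λ C′ → D (c ∷ C′)) (λ C′ → E (c ∷ C′)) r C))
          (identity (g r c) a (D C) (E C) _ _)
    where
    identity : ∀ x a d e f h → x * (a * d - e) - (a * f - h) ≡ a * (x * d - f) - (x * e - h)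
    identity = solve-∀

  -- Generalising over the inner minors D is what makes the induction on C go through.
  expand-swap : ∀ D x y C →
    expand (λ C′ → expand D y C′) x C ≡ - expand (λ C′ → expand D x C′) y C
  expand-swap D x y []      = refl
  expand-swap D x y (c ∷ C) = begin
    g x c * expand D y C - expand (λ C′ → g y c * D C′ - expand (D ∘ (c ∷_)) y C′) x C
      ≡⟨ cong (λ t → g x c * expand D y C - t) (expand-linear (g y c) D _ x C) ⟩
    g x c * expand D y C - (g y c * expand D x C - expand (λ C′ → expand (D ∘ (c ∷_)) y C′) x C)
      ≡⟨ cong (λ t → g x c * expand D y C - (g y c * expand D x C - t)) (expand-swap (D ∘ (c ∷_)) x y C) ⟩
    g x c * expand D y C - (g y c * expand D x C - - expand (λ C′ → expand (D ∘ (c ∷_)) x C′) y C)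
      ≡⟨ identity (g x c) (g y c) (expand D y C) (expand D x C) _ ⟩
    - (g y c * expand D x C - (g x c * expand D y C - expand (λ C′ → expand (D ∘ (c ∷_)) x C′) y C))
      ≡⟨ cong (λ t → - (g y c * expand D x C - t)) (sym (expand-linear (g x c) D _ y C)) ⟩
    - (g y c * expand D x C - expand (λ C′ → g x c * D C′ - expand (D ∘ (c ∷_)) x C′) y C) ∎
    where
    open ≡-Reasoning
    identity : ∀ a b e f h → a * e - (b * f - - h) ≡ - (b * f - (a * e - h))
    identity = solve-∀

  subdet-swap : ∀ x y R C → subdet (x ∷ y ∷ R) C ≡ - subdet (y ∷ x ∷ R) C
  subdet-swap x y R = expand-swap (subdet R) x y

  subdet-rotate-row : ∀ x R C → subdet (x ∷ R) C ≡ sign (length R) * subdet (R ++ [ x ]) C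
  subdet-rotate-row x []      C = sym (ℤP.*-identityˡ _)
  subdet-rotate-row x (r ∷ R) C = begin
    subdet (x ∷ r ∷ R) C
      ≡⟨ subdet-swap x r R C ⟩
    - expand (subdet (x ∷ R)) r C
      ≡⟨ cong -_ (expand-cong r C (λ C′ _ → subdet-rotate-row x R C′)) ⟩
    - expand (λ C′ → sign (length R) * subdet (R ++ [ x ]) C′) r C
      ≡⟨ cong -_ (expand-scale (sign (length R)) _ r C) ⟩
    - (sign (length R) * subdet (r ∷ R ++ [ x ]) C)
      ≡⟨ ℤP.neg-distribˡ-* (sign (length R)) _ ⟩
    - sign (length R) * subdet (r ∷ R ++ [ x ]) C
      ≡⟨ cong (_* subdet (r ∷ R ++ [ x ]) C) (sym (sign-suc (length R))) ⟩
    sign (length (r ∷ R)) * subdet (r ∷ R ++ [ x ]) C ∎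
    where open ≡-Reasoning

  expand-snoc : ∀ D r C c →
    expand D r (C ++ [ c ]) ≡ expand (λ C′ → D (C′ ++ [ c ])) r C + sign (length C) * (g r c * D C)
  expand-snoc D r []      c = identity (g r c * D [])
    where
    identity : ∀ x → x - + 0 ≡ + 0 + + 1 * x
    identity = solve-∀
  expand-snoc D r (a ∷ C) c =
    trans (cong (λ t → g r a * D (C ++ [ c ]) - t) (expand-snoc (λ C′ → D (a ∷ C′)) r C c))
          (trans (identity (g r a * D (C ++ [ c ])) _ (sign (length C)) (g r c * D (a ∷ C)))
                 (cong (λ s → expand (λ C′ → D (C′ ++ [ c ])) r (a ∷ C) + s * (g r c * D (a ∷ C)))
                       (sym (sign-suc (length C)))))
    where
    identity : ∀ x e s y → x - (e + s * y) ≡ (x - e) + - s * y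
    identity = solve-∀

  subdet-rotate-column : ∀ R C c → length R ≡ suc (length C) →
    subdet R (C ++ [ c ]) ≡ sign (length C) * subdet R (c ∷ C)
  subdet-rotate-column (r ∷ []) [] c _ = sym (ℤP.*-identityˡ _)
  subdet-rotate-column (r ∷ R) (a ∷ C) c len = begin
    expand (subdet R) r ((a ∷ C) ++ [ c ])
      ≡⟨ expand-snoc (subdet R) r (a ∷ C) c ⟩
    expand (λ C′ → subdet R (C′ ++ [ c ])) r (a ∷ C) + s′ * (g r c * subdet R (a ∷ C))
      ≡⟨ cong (λ t → t + s′ * (g r c * subdet R (a ∷ C))) (expand-cong r (a ∷ C) minor-rotated) ⟩
    expand (λ C′ → s * subdet R (c ∷ C′)) r (a ∷ C) + s′ * (g r c * subdet R (a ∷ C))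
      ≡⟨ cong (λ t → t + s′ * (g r c * subdet R (a ∷ C))) (expand-scale s (λ C′ → subdet R (c ∷ C′)) r (a ∷ C)) ⟩
    s * expand (λ C′ → subdet R (c ∷ C′)) r (a ∷ C) + s′ * (g r c * subdet R (a ∷ C))
      ≡⟨ cong (λ t → s * expand (λ C′ → subdet R (c ∷ C′)) r (a ∷ C) + t * (g r c * subdet R (a ∷ C)))
              (sign-suc (length C)) ⟩
    s * expand (λ C′ → subdet R (c ∷ C′)) r (a ∷ C) + - s * (g r c * subdet R (a ∷ C))
      ≡⟨ identity s _ _ ⟩
    - s * (g r c * subdet R (a ∷ C) - expand (λ C′ → subdet R (c ∷ C′)) r (a ∷ C))
      ≡⟨ cong (_* subdet (r ∷ R) (c ∷ a ∷ C)) (sym (sign-suc (length C))) ⟩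
    s′ * subdet (r ∷ R) (c ∷ a ∷ C) ∎
    where
    open ≡-Reasoning
    s s′ : ℤ
    s  = sign (length C)
    s′ = sign (length (a ∷ C))
    minor-rotated : ∀ C′ → suc (length C′) ≡ length (a ∷ C) →
                    subdet R (C′ ++ [ c ]) ≡ s * subdet R (c ∷ C′)
    minor-rotated C′ e =
      trans (subdet-rotate-column R C′ c (trans (ℕP.suc-injective len) (sym e)))
            (cong (λ k → sign k * subdet R (c ∷ C′)) (ℕP.suc-injective e))
    identity : ∀ s e x → s * e + - s * x ≡ - s * (x - e)
    identity = solve-∀

  subdet-rotate : ∀ x R → subdet (x ∷ R) (x ∷ R) ≡ subdet (R ++ [ x ]) (R ++ [ x ])
  subdet-rotate x R =
    trans (subdet-rotate-row x R (x ∷ R))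
          (sym (subdet-rotate-column (R ++ [ x ]) R x (trans (ListP.length-++ R) (ℕP.+-comm (length R) 1))))

  subdet-++-comm : ∀ A B → subdet (A ++ B) (A ++ B) ≡ subdet (B ++ A) (B ++ A)
  subdet-++-comm []      B = cong (λ L → subdet L L) (sym (ListP.++-identityʳ B))
  subdet-++-comm (x ∷ A) B = begin
    subdet (x ∷ A ++ B) (x ∷ A ++ B)                    ≡⟨ subdet-rotate x (A ++ B) ⟩
    subdet ((A ++ B) ++ [ x ]) ((A ++ B) ++ [ x ])      ≡⟨ cong (λ L → subdet L L) (ListP.++-assoc A B [ x ]) ⟩
    subdet (A ++ B ++ [ x ]) (A ++ B ++ [ x ])          ≡⟨ subdet-++-comm A (B ++ [ x ]) ⟩
    subdet ((B ++ [ x ]) ++ A) ((B ++ [ x ]) ++ A)      ≡⟨ cong (λ L → subdet L L) (ListP.++-assoc B [ x ] A) ⟩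
    subdet (B ++ x ∷ A) (B ++ x ∷ A) ∎
    where open ≡-Reasoning

  subdet-zero-column : ∀ R C c → All (λ r → g r c ≡ + 0) R → length R ≡ suc (length C) →
                       subdet R (c ∷ C) ≡ + 0
  subdet-zero-column (r ∷ R) C c (z ∷ zs) len =
    cong₂ (λ a b → a * subdet R C - b) z
          (expand-zero-minors r C (λ C′ e →
             subdet-zero-column R C′ c zs (trans (ℕP.suc-injective len) (sym e))))

  data Chain : List ℕ → Set where
    []   : Chain []
    sole : ∀ a → Chain [ a ]
    link : ∀ {a b R} → g a b ≡ + 1 → g b a ≡ + 1 → All (λ c → g a c ≡ + 0 × g c a ≡ + 0) R →
           Chain (b ∷ R) → Chain (a ∷ b ∷ R)

  diagonal : List ℕ → List ℤ
  diagonal = map (λ a → g a a)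

  subdet-chain : ∀ R → Chain R → subdet R R ≡ continuant (diagonal R)
  subdet-chain []          []         = refl
  subdet-chain (a ∷ [])    (sole a)   = trans (ℤP.+-identityʳ _) (ℤP.*-identityʳ (g a a))
  subdet-chain (a ∷ b ∷ R) (link gab gba zeros chain) = begin
    g a a * subdet (b ∷ R) (b ∷ R)
      - (g a b * (g b a * subdet R R - expand (λ C′ → subdet R (a ∷ C′)) b R)
         - expand (λ C′ → subdet (b ∷ R) (a ∷ b ∷ C′)) a R)
      ≡⟨ cong₂ (λ x y → g a a * subdet (b ∷ R) (b ∷ R) - (g a b * (g b a * subdet R R - x) - y))
               (expand-zero-minors b R (λ C′ e →
                  subdet-zero-column R C′ a (All.map proj₂ zeros) (sym e)))
               (expand-zero-row a R (All.map proj₁ zeros)) ⟩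
    g a a * subdet (b ∷ R) (b ∷ R) - (g a b * (g b a * subdet R R - + 0) - + 0)
      ≡⟨ cong₂ (λ x y → g a a * subdet (b ∷ R) (b ∷ R) - (x * (y * subdet R R - + 0) - + 0)) gab gba ⟩
    g a a * subdet (b ∷ R) (b ∷ R) - (+ 1 * (+ 1 * subdet R R - + 0) - + 0)
      ≡⟨ identity (g a a) _ _ ⟩
    g a a * subdet (b ∷ R) (b ∷ R) - subdet R R
      ≡⟨ cong₂ (λ x y → g a a * x - y) (subdet-chain (b ∷ R) chain) (subdet-chain R (chain-tail chain)) ⟩
    continuant (diagonal (a ∷ b ∷ R)) ∎
    where
    open ≡-Reasoning
    chain-tail : ∀ {b R} → Chain (b ∷ R) → Chain R
    chain-tail (sole _)       = []
    chain-tail (link _ _ _ c) = c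
    identity : ∀ x u v → x * u - (+ 1 * (+ 1 * v - + 0) - + 0) ≡ x * u - v
    identity = solve-∀

range : ℕ → ℕ → List ℕ
range a zero    = []
range a (suc L) = a ∷ range (suc a) L

range-++ : ∀ a p q → range a (p ℕ.+ q) ≡ range a p ++ range (a ℕ.+ p) q
range-++ a zero    q = cong (λ b → range b q) (sym (ℕP.+-identityʳ a))
range-++ a (suc p) q =
  cong (a ∷_) (trans (range-++ (suc a) p q) (cong (λ b → range (suc a) p ++ range b q) (sym (ℕP.+-suc a p))))

length-range : ∀ a L → length (range a L) ≡ L
length-range a zero    = refl
length-range a (suc L) = cong suc (length-range (suc a) L)

All-range : ∀ {P : ℕ → Set} a L → (∀ c → a ≤ c → c < a ℕ.+ L → P c) → All P (range a L)
All-range a zero    f = []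
All-range a (suc L) f =
  f a ℕP.≤-refl (ℕP.m<m+n a (s≤s z≤n))
  ∷ All-range (suc a) L (λ c a<c c<a+L → f c (ℕP.<⇒≤ a<c) (ℕP.≤-trans c<a+L (ℕP.≤-reflexive (sym (ℕP.+-suc a L)))))

tabulate-toℕ : ∀ L (f : ℕ → ℕ) → tabulate {n = L} (f ∘ toℕ) ≡ map f (range 0 L)
tabulate-toℕ L f = go L 0 f
  where
  go : ∀ L a (f : ℕ → ℕ) → tabulate {n = L} (λ r → f (a ℕ.+ toℕ r)) ≡ map f (range a L)
  go zero    a f = refl
  go (suc L) a f = cong₂ _∷_ (cong f (ℕP.+-identityʳ a))
                             (trans (tabulate-cong (λ r → cong f (ℕP.+-suc a (toℕ r)))) (go L (suc a) f))

replicate-++ : ∀ {A : Set} x y (v : A) → replicate x v ++ replicate y v ≡ replicate (x ℕ.+ y) v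
replicate-++ zero    y v = refl
replicate-++ (suc x) y v = cong (v ∷_) (replicate-++ x y v)

skip-below : ∀ {m b} → suc b < m → skip m b ≡ suc b
skip-below {m} {b} lt rewrite dec-true (suc b ℕ.<? m) lt = refl

skip-above : ∀ {m b} → m ≤ suc b → skip m b ≡ suc (suc b)
skip-above {m} {b} le rewrite dec-false (suc b ℕ.<? m) (ℕP.≤⇒≯ le) = refl

map-skip-below : ∀ p a L → a ℕ.+ L ≤ p → map (skip (suc p)) (range a L) ≡ range (suc a) L
map-skip-below p a zero    h = refl
map-skip-below p a (suc L) h =
  cong₂ _∷_ (skip-below (s≤s (ℕP.<-≤-trans (ℕP.m<m+n a (s≤s z≤n)) h)))
            (map-skip-below p (suc a) L (ℕP.≤-trans (ℕP.≤-reflexive (sym (ℕP.+-suc a L))) h))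

map-skip-above : ∀ p a L → p ≤ a → map (skip (suc p)) (range a L) ≡ range (suc (suc a)) L
map-skip-above p a zero    h = refl
map-skip-above p a (suc L) h = cong₂ _∷_ (skip-above (s≤s h)) (map-skip-above p (suc a) L (ℕP.m≤n⇒m≤1+n h))

skip-rows : ∀ p q → map (skip (suc p)) (range 0 (p ℕ.+ q)) ≡ range 1 p ++ range (suc (suc p)) q
skip-rows p q = begin
  map (skip (suc p)) (range 0 (p ℕ.+ q))                           ≡⟨ cong (map (skip (suc p))) (range-++ 0 p q) ⟩
  map (skip (suc p)) (range 0 p ++ range p q)                      ≡⟨ ListP.map-++ (skip (suc p)) (range 0 p) _ ⟩
  map (skip (suc p)) (range 0 p) ++ map (skip (suc p)) (range p q) ≡⟨ cong₂ _++_ (map-skip-below p 0 p ℕP.≤-refl)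
                                                                                  (map-skip-above p p q ℕP.≤-refl) ⟩
  range 1 p ++ range (suc (suc p)) q                               ∎
  where open ≡-Reasoning

≡ᵇ-refl : ∀ a → (a ≡ᵇ a) ≡ true
≡ᵇ-refl a = dec-true (a ℕ.≟ a) refl

≢⇒≡ᵇ-false : ∀ {a b} → a ≢ b → (a ≡ᵇ b) ≡ false
≢⇒≡ᵇ-false {a} {b} = dec-false (a ℕ.≟ b)

≡ᵇ-∧-false : ∀ {a b c d} → ¬ (a ≡ c × b ≡ d) → ((a ≡ᵇ c) ∧ (b ≡ᵇ d)) ≡ false
≡ᵇ-∧-false {a} {b} {c} {d} h with a ℕ.≟ c
... | yes refl rewrite ≡ᵇ-refl a | ≢⇒≡ᵇ-false (λ b≡d → h (refl , b≡d)) = refl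
... | no a≢c   rewrite ≢⇒≡ᵇ-false a≢c = refl

2≤⇒≢1 : ∀ {b} → 2 ≤ b → b ≢ 1
2≤⇒≢1 (s≤s (s≤s _)) ()

module Cyclic (n i : ℕ) where

  open Minors (Pentry n i) public

  N σ : ℕ
  N = 2 ℕ.* n
  σ = 2 ℕ.* i

  Pentry-diag : ∀ {a} → a ≢ σ → Pentry n i a a ≡ - + 2
  Pentry-diag {a} a≢σ rewrite ≡ᵇ-refl a | ≢⇒≡ᵇ-false a≢σ = refl

  Pentry-diag-σ : Pentry n i σ σ ≡ - + 3
  Pentry-diag-σ rewrite ≡ᵇ-refl σ = refl

  Pentry-succ : ∀ a → Pentry n i a (suc a) ≡ + 1 × Pentry n i (suc a) a ≡ + 1
  Pentry-succ a
    rewrite ≢⇒≡ᵇ-false (ℕP.<⇒≢ (ℕP.n<1+n a)) | ≢⇒≡ᵇ-false (ℕP.1+n≢n {a})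
          | ≢⇒≡ᵇ-false (ℕP.>⇒≢ (ℕP.m<n⇒m<1+n (ℕP.n<1+n a))) | ≡ᵇ-refl a = refl , refl

  Pentry-corner : 3 ≤ N → Pentry n i 1 N ≡ + 1 × Pentry n i N 1 ≡ + 1
  Pentry-corner 3≤N
    rewrite ≢⇒≡ᵇ-false (ℕP.<⇒≢ (ℕP.<-trans (s≤s (s≤s z≤n)) 3≤N)) | ≢⇒≡ᵇ-false (ℕP.<⇒≢ 3≤N)
          | ≢⇒≡ᵇ-false (ℕP.>⇒≢ (s≤s (ℕP.<-trans (s≤s z≤n) 3≤N)))
          | ≢⇒≡ᵇ-false (ℕP.>⇒≢ (ℕP.<-trans (s≤s (s≤s z≤n)) 3≤N)) | ≡ᵇ-refl N = refl , refl

  Pentry-offdiag : ∀ {a b} → a ≢ b → suc a ≢ b → suc b ≢ a →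
                   ¬ (a ≡ 1 × b ≡ N) → ¬ (a ≡ N × b ≡ 1) → Pentry n i a b ≡ + 0
  Pentry-offdiag a≢b 1+a≢b 1+b≢a no-corner no-corner′
    rewrite ≢⇒≡ᵇ-false a≢b | ≢⇒≡ᵇ-false 1+a≢b | ≢⇒≡ᵇ-false 1+b≢a
          | ≡ᵇ-∧-false no-corner | ≡ᵇ-∧-false no-corner′ = refl

  Pentry-far : ∀ {a b} → suc (suc a) ≤ b → (a ≡ 1 → b ≢ N) → Pentry n i a b ≡ + 0 × Pentry n i b a ≡ + 0
  Pentry-far {a} {b} a+2≤b no-corner =
    Pentry-offdiag (ℕP.<⇒≢ a<b) (ℕP.<⇒≢ a+2≤b) (ℕP.>⇒≢ (ℕP.m<n⇒m<1+n a<b))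
                   (λ (a≡1 , b≡N) → no-corner a≡1 b≡N) (λ (_ , b≡1) → b≢1 b≡1)
    , Pentry-offdiag (ℕP.>⇒≢ a<b) (ℕP.>⇒≢ (ℕP.m<n⇒m<1+n a<b)) (ℕP.<⇒≢ a+2≤b)
                     (λ (b≡1 , _) → b≢1 b≡1) (λ (b≡N , a≡1) → no-corner a≡1 b≡N)
    where
    a<b : a < b
    a<b = ℕP.<-trans (ℕP.n<1+n a) a+2≤b
    b≢1 : b ≢ 1
    b≢1 = 2≤⇒≢1 (ℕP.≤-trans (s≤s (s≤s z≤n)) a+2≤b)

  chain-range : ∀ a L → a ℕ.+ L ≤ N → Chain (range a L)
  chain-range a zero          _ = []
  chain-range a (suc zero)    _ = sole a
  chain-range a (suc (suc L)) h =
    link (proj₁ (Pentry-succ a)) (proj₂ (Pentry-succ a))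
         (All-range (suc (suc a)) L (λ c a+2≤c c<a+2+L →
            Pentry-far a+2≤c (λ _ c≡N → ℕP.<⇒≢ (ℕP.<-≤-trans c<a+2+L (ℕP.≤-trans a+2+L≤a+L+2 h)) c≡N)))
         (chain-range (suc a) (suc L) (ℕP.≤-trans (ℕP.≤-reflexive (sym (ℕP.+-suc a (suc L)))) h))
    where
    a+2+L≤a+L+2 : suc (suc a) ℕ.+ L ≤ a ℕ.+ suc (suc L)
    a+2+L≤a+L+2 = ℕP.≤-reflexive (sym (trans (ℕP.+-suc a (suc L)) (cong suc (ℕP.+-suc a L))))

  -- The cycle 1, …, N read from a onwards, wrapping round from N to 1 and stopping before p+1.
  chain-wrap : ∀ a L p → a ℕ.+ L ≡ suc N → suc (suc p) ≤ a → 3 ≤ N → Chain (range a L ++ range 1 p)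
  chain-wrap a zero p a≡N+1 p+2≤a _ =
    chain-range 1 p (ℕP.≤-pred (ℕP.≤-trans p+2≤a (ℕP.≤-reflexive (trans (sym (ℕP.+-identityʳ a)) a≡N+1))))
  chain-wrap a (suc zero) zero    _ _ _ = sole a
  chain-wrap a (suc zero) (suc p) a+1≡N+1 p+3≤a 3≤N
    rewrite ℕP.suc-injective (trans (sym (ℕP.+-comm a 1)) a+1≡N+1) =
    link (proj₂ (Pentry-corner 3≤N)) (proj₁ (Pentry-corner 3≤N))
         (All-range 2 p (λ c 2≤c c<2+p →
            swap (Pentry-far (ℕP.≤-trans (s≤s (s≤s (ℕP.≤-pred c<2+p))) p+3≤a) (λ c≡1 → ⊥-elim (2≤⇒≢1 2≤c c≡1)))))
         (chain-range 1 (suc p) (ℕP.≤-trans (ℕP.n≤1+n _) p+3≤a))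
  chain-wrap a (suc (suc L)) p a+L+2≡N+1 p+2≤a 3≤N =
    link (proj₁ (Pentry-succ a)) (proj₂ (Pentry-succ a))
         (++⁺ (All-range (suc (suc a)) L (λ c a+2≤c _ → Pentry-far a+2≤c (λ a≡1 → ⊥-elim (2≤⇒≢1 2≤a a≡1))))
              (All-range 1 p (λ c _ c<1+p →
                 swap (Pentry-far (ℕP.≤-trans (s≤s (s≤s (ℕP.≤-pred c<1+p))) p+2≤a) (λ _ a≡N → ℕP.<⇒≢ a<N a≡N)))))
         (chain-wrap (suc a) (suc L) p (trans (sym (ℕP.+-suc a (suc L))) a+L+2≡N+1) (ℕP.m≤n⇒m≤1+n p+2≤a) 3≤N)
    where
    2≤a : 2 ≤ a
    2≤a = ℕP.≤-trans (s≤s (s≤s z≤n)) p+2≤a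
    a<N : a < N
    a<N = ℕP.≤-pred (ℕP.≤-trans (s≤s (s≤s (ℕP.m≤m+n a L)))
                                 (ℕP.≤-reflexive (trans (sym (trans (ℕP.+-suc a (suc L)) (cong suc (ℕP.+-suc a L))))
                                                        a+L+2≡N+1)))

  negated-diagonal : List ℕ → List ℤ
  negated-diagonal = map (λ a → - Pentry n i a a)

  negated-diagonal-away : ∀ a L → σ < a ⊎ a ℕ.+ L ≤ σ → negated-diagonal (range a L) ≡ replicate L (+ 2)
  negated-diagonal-away a zero    _ = refl
  negated-diagonal-away a (suc L) (inj₁ σ<a) =
    cong₂ _∷_ (cong -_ (Pentry-diag (ℕP.>⇒≢ σ<a))) (negated-diagonal-away (suc a) L (inj₁ (ℕP.m<n⇒m<1+n σ<a)))
  negated-diagonal-away a (suc L) (inj₂ a+L+1≤σ) =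
    cong₂ _∷_ (cong -_ (Pentry-diag (ℕP.<⇒≢ (ℕP.<-≤-trans (ℕP.m<m+n a (s≤s z≤n)) a+L+1≤σ))))
              (negated-diagonal-away (suc a) L (inj₂ (ℕP.≤-trans (ℕP.≤-reflexive (sym (ℕP.+-suc a L))) a+L+1≤σ)))

  negated-diagonal-hit : ∀ a x y → a ℕ.+ x ≡ σ →
    negated-diagonal (range a (x ℕ.+ suc y)) ≡ replicate x (+ 2) ++ + 3 ∷ replicate y (+ 2)
  negated-diagonal-hit a x y a+x≡σ = begin
    negated-diagonal (range a (x ℕ.+ suc y))
      ≡⟨ cong negated-diagonal (range-++ a x (suc y)) ⟩
    negated-diagonal (range a x ++ range (a ℕ.+ x) (suc y))
      ≡⟨ ListP.map-++ _ (range a x) _ ⟩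
    negated-diagonal (range a x) ++ - Pentry n i (a ℕ.+ x) (a ℕ.+ x) ∷ negated-diagonal (range (suc (a ℕ.+ x)) y)
      ≡⟨ cong₂ _++_ (negated-diagonal-away a x (inj₂ (ℕP.≤-reflexive a+x≡σ)))
                    (cong₂ _∷_ (trans (cong (λ b → - Pentry n i b b) a+x≡σ) (cong -_ Pentry-diag-σ))
                               (negated-diagonal-away (suc (a ℕ.+ x)) y (inj₁ (s≤s (ℕP.≤-reflexive (sym a+x≡σ)))))) ⟩
    replicate x (+ 2) ++ + 3 ∷ replicate y (+ 2) ∎
    where open ≡-Reasoning

  sign-odd : ∀ {k} → suc k ≡ N → sign k ≡ - + 1
  sign-odd {k} k+1≡N =
    trans (sym (ℤP.neg-involutive (sign k)))
          (cong -_ (trans (sym (sign-suc k)) (trans (cong sign k+1≡N) (sign-even n))))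
    where
    sign-even : ∀ n → sign (2 ℕ.* n) ≡ + 1
    sign-even zero    = refl
    sign-even (suc n) = trans (cong sign (ℕP.*-suc 2 n)) (sign-even n)

  continuant-diagonal : ∀ R → suc (length R) ≡ N → continuant (diagonal R) ≡ - continuant (negated-diagonal R)
  continuant-diagonal R len = begin
    continuant (diagonal R)
      ≡⟨ continuant-negate (diagonal R) ⟩
    sign (length (diagonal R)) * continuant (map -_ (diagonal R))
      ≡⟨ cong₂ (λ k us → sign k * continuant us) (ListP.length-map _ R) (sym (ListP.map-∘ R)) ⟩
    sign (length R) * continuant (negated-diagonal R)
      ≡⟨ cong (_* continuant (negated-diagonal R)) (sign-odd len) ⟩
    - + 1 * continuant (negated-diagonal R)
      ≡⟨ ℤP.-1*i≡-i _ ⟩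
    - continuant (negated-diagonal R) ∎
    where open ≡-Reasoning

  det-W3-negated-diagonal : ∀ j p q → j ∸ n ≡ suc p → suc (p ℕ.+ q) ≡ N → 3 ≤ N →
    det (N ∸ 1) (W3 n i j) ≡ - continuant (negated-diagonal (range (suc (suc p)) q) ++ negated-diagonal (range 1 p))
  det-W3-negated-diagonal j p q m≡p+1 p+q+1≡N 3≤N = begin
    det (N ∸ 1) (W3 n i j)
      ≡⟨ det-tabulate (N ∸ 1) rows rows ⟩
    subdet (tabulate rows) (tabulate rows)
      ≡⟨ cong (λ L → subdet L L) rows≡ ⟩
    subdet (range 1 p ++ range (suc (suc p)) q) (range 1 p ++ range (suc (suc p)) q)
      ≡⟨ subdet-++-comm (range 1 p) (range (suc (suc p)) q) ⟩
    subdet path path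
      ≡⟨ subdet-chain path (chain-wrap (suc (suc p)) q p (cong suc p+q+1≡N) ℕP.≤-refl 3≤N) ⟩
    continuant (diagonal path)
      ≡⟨ continuant-diagonal path length-path ⟩
    - continuant (negated-diagonal path)
      ≡⟨ cong (λ us → - continuant us) (ListP.map-++ _ (range (suc (suc p)) q) (range 1 p)) ⟩
    - continuant (negated-diagonal (range (suc (suc p)) q) ++ negated-diagonal (range 1 p)) ∎
    where
    open ≡-Reasoning
    rows : Fin (N ∸ 1) → ℕ
    rows r = skip (j ∸ n) (toℕ r)
    rows≡ : tabulate rows ≡ range 1 p ++ range (suc (suc p)) q
    rows≡ = trans (tabulate-toℕ (N ∸ 1) (skip (j ∸ n)))
                  (trans (cong₂ (λ m L → map (skip m) (range 0 L)) m≡p+1 (cong (_∸ 1) (sym p+q+1≡N)))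
                         (skip-rows p q))
    path : List ℕ
    path = range (suc (suc p)) q ++ range 1 p
    length-path : suc (length path) ≡ N
    length-path = trans (cong suc (trans (ListP.length-++ (range (suc (suc p)) q))
                                         (trans (cong₂ ℕ._+_ (length-range _ q) (length-range 1 p)) (ℕP.+-comm q p))))
                        p+q+1≡N

  det-W3-centre : ∀ j p q → j ∸ n ≡ suc p → suc (p ℕ.+ q) ≡ N → σ ≡ suc p → 3 ≤ N →
    det (N ∸ 1) (W3 n i j) ≡ + 0 * + 0 - + N - + N * + 0
  det-W3-centre j p q m≡p+1 p+q+1≡N σ≡p+1 3≤N = begin
    det (N ∸ 1) (W3 n i j)
      ≡⟨ det-W3-negated-diagonal j p q m≡p+1 p+q+1≡N 3≤N ⟩
    - continuant (negated-diagonal (range (suc (suc p)) q) ++ negated-diagonal (range 1 p))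
      ≡⟨ cong (λ us → - continuant us)
              (cong₂ _++_ (negated-diagonal-away _ q (inj₁ (s≤s (ℕP.≤-reflexive σ≡p+1))))
                          (negated-diagonal-away 1 p (inj₂ (ℕP.≤-reflexive (sym σ≡p+1))))) ⟩
    - continuant (replicate q (+ 2) ++ replicate p (+ 2))
      ≡⟨ cong (λ us → - continuant us) (replicate-++ q p (+ 2)) ⟩
    - continuant (replicate (q ℕ.+ p) (+ 2))
      ≡⟨ cong -_ (continuant-twos (q ℕ.+ p)) ⟩
    - + suc (q ℕ.+ p)
      ≡⟨ cong (λ k → - + k) (trans (cong suc (ℕP.+-comm q p)) p+q+1≡N) ⟩
    - + N
      ≡⟨ identity (+ N) ⟩
    + 0 * + 0 - + N - + N * + 0 ∎
    where
    open ≡-Reasoning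
    identity : ∀ N → - N ≡ + 0 * + 0 - N - N * + 0
    identity = solve-∀

  det-W3-after : ∀ j p q x y → j ∸ n ≡ suc p → suc (p ℕ.+ q) ≡ N → suc (suc p) ℕ.+ x ≡ σ → q ≡ x ℕ.+ suc y → 3 ≤ N →
    det (N ∸ 1) (W3 n i j) ≡ + suc x * + suc x - + N - + N * + suc x
  det-W3-after j p q x y m≡p+1 p+q+1≡N p+2+x≡σ q≡x+y+1 3≤N = begin
    det (N ∸ 1) (W3 n i j)
      ≡⟨ det-W3-negated-diagonal j p q m≡p+1 p+q+1≡N 3≤N ⟩
    - continuant (negated-diagonal (range (suc (suc p)) q) ++ negated-diagonal (range 1 p))
      ≡⟨ cong (λ us → - continuant us)
              (cong₂ _++_ (trans (cong (λ L → negated-diagonal (range (suc (suc p)) L)) q≡x+y+1)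
                                 (negated-diagonal-hit _ x y p+2+x≡σ))
                          (negated-diagonal-away 1 p (inj₂ p+1≤σ))) ⟩
    - continuant ((replicate x (+ 2) ++ + 3 ∷ replicate y (+ 2)) ++ replicate p (+ 2))
      ≡⟨ cong (λ us → - continuant us)
              (trans (ListP.++-assoc (replicate x (+ 2)) _ _)
                     (cong (λ us → replicate x (+ 2) ++ + 3 ∷ us) (replicate-++ y p (+ 2)))) ⟩
    - continuant (replicate x (+ 2) ++ + 3 ∷ replicate (y ℕ.+ p) (+ 2))
      ≡⟨ cong -_ (continuant-defect x (y ℕ.+ p)) ⟩
    - (+ suc (suc (x ℕ.+ (y ℕ.+ p))) + + suc x * + suc (y ℕ.+ p))
      ≡⟨ identity (+ x) (+ y) (+ p) ⟩
    + suc x * + suc x - + suc (p ℕ.+ (x ℕ.+ suc y)) - + suc (p ℕ.+ (x ℕ.+ suc y)) * + suc x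
      ≡⟨ cong (λ k → + suc x * + suc x - + k - + k * + suc x)
              (trans (cong (λ l → suc (p ℕ.+ l)) (sym q≡x+y+1)) p+q+1≡N) ⟩
    + suc x * + suc x - + N - + N * + suc x ∎
    where
    open ≡-Reasoning
    p+1≤σ : 1 ℕ.+ p ≤ σ
    p+1≤σ = ℕP.≤-trans (ℕP.n≤1+n (suc p)) (ℕP.≤-trans (ℕP.m≤m+n (suc (suc p)) x) (ℕP.≤-reflexive p+2+x≡σ))
    identity : ∀ x y p → - (+ 2 + (x + (y + p)) + (+ 1 + x) * (+ 1 + (y + p)))
                         ≡ (+ 1 + x) * (+ 1 + x) - (+ 1 + (p + (x + (+ 1 + y))))
                           - (+ 1 + (p + (x + (+ 1 + y)))) * (+ 1 + x)
    identity = solve-∀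

  det-W3-before : ∀ j p q x y → j ∸ n ≡ suc p → suc (p ℕ.+ q) ≡ N → suc x ≡ σ → p ≡ x ℕ.+ suc y → 3 ≤ N →
    det (N ∸ 1) (W3 n i j) ≡ + suc y * + suc y - + N - + N * + suc y
  det-W3-before j p q x y m≡p+1 p+q+1≡N x+1≡σ p≡x+y+1 3≤N = begin
    det (N ∸ 1) (W3 n i j)
      ≡⟨ det-W3-negated-diagonal j p q m≡p+1 p+q+1≡N 3≤N ⟩
    - continuant (negated-diagonal (range (suc (suc p)) q) ++ negated-diagonal (range 1 p))
      ≡⟨ cong (λ us → - continuant us)
              (cong₂ _++_ (negated-diagonal-away _ q (inj₁ σ<p+2))
                          (trans (cong (λ L → negated-diagonal (range 1 L)) p≡x+y+1)
                                 (negated-diagonal-hit 1 x y x+1≡σ))) ⟩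
    - continuant (replicate q (+ 2) ++ replicate x (+ 2) ++ + 3 ∷ replicate y (+ 2))
      ≡⟨ cong (λ us → - continuant us)
              (trans (sym (ListP.++-assoc (replicate q (+ 2)) (replicate x (+ 2)) _))
                     (cong (_++ + 3 ∷ replicate y (+ 2)) (replicate-++ q x (+ 2)))) ⟩
    - continuant (replicate (q ℕ.+ x) (+ 2) ++ + 3 ∷ replicate y (+ 2))
      ≡⟨ cong -_ (continuant-defect (q ℕ.+ x) y) ⟩
    - (+ suc (suc (q ℕ.+ x ℕ.+ y)) + + suc (q ℕ.+ x) * + suc y)
      ≡⟨ identity (+ q) (+ x) (+ y) ⟩
    + suc y * + suc y - + suc (x ℕ.+ suc y ℕ.+ q) - + suc (x ℕ.+ suc y ℕ.+ q) * + suc y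
      ≡⟨ cong (λ k → + suc y * + suc y - + k - + k * + suc y)
              (trans (cong (λ l → suc (l ℕ.+ q)) (sym p≡x+y+1)) p+q+1≡N) ⟩
    + suc y * + suc y - + N - + N * + suc y ∎
    where
    open ≡-Reasoning
    σ<p+2 : σ < suc (suc p)
    σ<p+2 = s≤s (ℕP.≤-trans (ℕP.≤-reflexive (sym x+1≡σ))
                            (s≤s (ℕP.≤-trans (ℕP.m≤m+n x (suc y)) (ℕP.≤-reflexive (sym p≡x+y+1)))))
    identity : ∀ q x y → - (+ 2 + (q + x + y) + (+ 1 + (q + x)) * (+ 1 + y))
                         ≡ (+ 1 + y) * (+ 1 + y) - (+ 1 + (x + (+ 1 + y) + q))
                           - (+ 1 + (x + (+ 1 + y) + q)) * (+ 1 + y)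
    identity = solve-∀

  det-W3-σ≤m : ∀ j p q t → j ∸ n ≡ suc p → suc (p ℕ.+ q) ≡ N → σ ℕ.+ t ≡ suc p → 1 ≤ σ → 3 ≤ N →
    det (N ∸ 1) (W3 n i j) ≡ + t * + t - + N - + N * + t
  det-W3-σ≤m j p q zero    m≡p+1 p+q+1≡N σ+0≡p+1 _ 3≤N =
    det-W3-centre j p q m≡p+1 p+q+1≡N (trans (sym (ℕP.+-identityʳ σ)) σ+0≡p+1) 3≤N
  det-W3-σ≤m j p q (suc y) m≡p+1 p+q+1≡N σ+y+1≡p+1 1≤σ 3≤N =
    det-W3-before j p q (σ ∸ 1) y m≡p+1 p+q+1≡N x+1≡σ
                  (sym (ℕP.suc-injective (trans (cong (ℕ._+ suc y) x+1≡σ) σ+y+1≡p+1))) 3≤N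
    where
    x+1≡σ : suc (σ ∸ 1) ≡ σ
    x+1≡σ = ℕP.m+[n∸m]≡n 1≤σ

  det-W3-σ>m : ∀ j p q t → j ∸ n ≡ suc p → suc (p ℕ.+ q) ≡ N → suc p ℕ.+ t ≡ σ → σ ≤ N → 3 ≤ N →
    det (N ∸ 1) (W3 n i j) ≡ + t * + t - + N - + N * + t
  det-W3-σ>m j p q zero    m≡p+1 p+q+1≡N p+1+0≡σ _ 3≤N =
    det-W3-centre j p q m≡p+1 p+q+1≡N (sym (trans (sym (ℕP.+-identityʳ (suc p))) p+1+0≡σ)) 3≤N
  det-W3-σ>m j p q (suc x) m≡p+1 p+q+1≡N p+x+2≡σ σ≤N 3≤N =
    det-W3-after j p q x (q ∸ suc x) m≡p+1 p+q+1≡N (trans (sym (cong suc (ℕP.+-suc p x))) p+x+2≡σ)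
                 (trans (sym (ℕP.m+[n∸m]≡n x+1≤q)) (sym (ℕP.+-suc x (q ∸ suc x)))) 3≤N
    where
    x+1≤q : suc x ≤ q
    x+1≤q = ℕP.+-cancelˡ-≤ (suc p) (suc x) q
              (ℕP.≤-trans (ℕP.≤-reflexive p+x+2≡σ) (ℕP.≤-trans σ≤N (ℕP.≤-reflexive (sym p+q+1≡N))))

formula-σ≤m : ∀ m i n t → 2 ℕ.* i ℕ.+ t ≡ m →
  + t * + t - + (2 ℕ.* n) - + (2 ℕ.* n) * + t
    ≡ + m * + m - + 4 * + m * + i + + 4 * + i * + i - + 2 * + n - + 2 * + n * (+ m - + 2 * + i)
formula-σ≤m m i n t σ+t≡m = begin
  + t * + t - + (2 ℕ.* n) - + (2 ℕ.* n) * + t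
    ≡⟨ cong (λ N → + t * + t - N - N * + t) (ℤP.pos-* 2 n) ⟩
  + t * + t - + 2 * + n - + 2 * + n * + t
    ≡⟨ identity (+ i) (+ n) (+ t) ⟩
  M * M - + 4 * M * + i + + 4 * + i * + i - + 2 * + n - + 2 * + n * (M - + 2 * + i)
    ≡⟨ cong (λ M → M * M - + 4 * M * + i + + 4 * + i * + i - + 2 * + n - + 2 * + n * (M - + 2 * + i)) M≡m ⟩
  + m * + m - + 4 * + m * + i + + 4 * + i * + i - + 2 * + n - + 2 * + n * (+ m - + 2 * + i) ∎
  where
  open ≡-Reasoning
  M : ℤ
  M = + 2 * + i + + t
  M≡m : M ≡ + m
  M≡m = trans (cong (_+ + t) (sym (ℤP.pos-* 2 i))) (cong +_ σ+t≡m)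
  identity : ∀ i n t → t * t - + 2 * n - + 2 * n * t
             ≡ (+ 2 * i + t) * (+ 2 * i + t) - + 4 * (+ 2 * i + t) * i + + 4 * i * i - + 2 * n
               - + 2 * n * ((+ 2 * i + t) - + 2 * i)
  identity = solve-∀

formula-σ>m : ∀ m i n t → m ℕ.+ t ≡ 2 ℕ.* i →
  + t * + t - + (2 ℕ.* n) - + (2 ℕ.* n) * + t
    ≡ + m * + m - + 4 * + m * + i + + 4 * + i * + i - + 2 * + n + + 2 * + n * (+ m - + 2 * + i)
formula-σ>m m i n t m+t≡σ = begin
  + t * + t - + (2 ℕ.* n) - + (2 ℕ.* n) * + t
    ≡⟨ cong (λ N → + t * + t - N - N * + t) (ℤP.pos-* 2 n) ⟩
  + t * + t - + 2 * + n - + 2 * + n * + t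
    ≡⟨ identity₁ (+ m) (+ n) (+ t) ⟩
  shape (+ m + + t)
    ≡⟨ cong shape (trans (cong +_ m+t≡σ) (ℤP.pos-* 2 i)) ⟩
  shape (+ 2 * + i)
    ≡⟨ identity₂ (+ m) (+ i) (+ n) ⟩
  + m * + m - + 4 * + m * + i + + 4 * + i * + i - + 2 * + n + + 2 * + n * (+ m - + 2 * + i) ∎
  where
  open ≡-Reasoning
  shape : ℤ → ℤ
  shape S = + m * + m - + 2 * + m * S + S * S - + 2 * + n + + 2 * + n * (+ m - S)
  identity₁ : ∀ m n t → t * t - + 2 * n - + 2 * n * t
              ≡ m * m - + 2 * m * (m + t) + (m + t) * (m + t) - + 2 * n + + 2 * n * (m - (m + t))
  identity₁ = solve-∀
  identity₂ : ∀ m i n → m * m - + 2 * m * (+ 2 * i) + (+ 2 * i) * (+ 2 * i) - + 2 * n + + 2 * n * (m - + 2 * i)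
              ≡ m * m - + 4 * m * i + + 4 * i * i - + 2 * n + + 2 * n * (m - + 2 * i)
  identity₂ = solve-∀

lemma10 : (n i j : ℕ) → 2 ≤ n → 1 ≤ i → i ≤ n → n ℕ.+ 1 ≤ j → j ≤ 3 ℕ.* n →
    ((2 ℕ.* i ≤ j ∸ n →
       det (2 ℕ.* n ∸ 1) (W3 n i j)
         ≡ + (j ∸ n) * + (j ∸ n) - + 4 * + (j ∸ n) * + i + + 4 * + i * + i - + 2 * + n
           - + 2 * + n * (+ (j ∸ n) - + 2 * + i))
    × (¬ (2 ℕ.* i ≤ j ∸ n) →
       det (2 ℕ.* n ∸ 1) (W3 n i j)
         ≡ + (j ∸ n) * + (j ∸ n) - + 4 * + (j ∸ n) * + i + + 4 * + i * + i - + 2 * + n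
           + + 2 * + n * (+ (j ∸ n) - + 2 * + i)))
lemma10 n i j 2≤n 1≤i i≤n n+1≤j j≤3n =
  (λ σ≤m → trans (det-W3-σ≤m j p q (m ∸ σ) m≡p+1 p+q+1≡N (trans (ℕP.m+[n∸m]≡n σ≤m) m≡p+1) 1≤σ 3≤N)
                 (formula-σ≤m m i n (m ∸ σ) (ℕP.m+[n∸m]≡n σ≤m))) ,
  (λ σ≰m → let m≤σ = ℕP.<⇒≤ (ℕP.≰⇒> σ≰m) in
           trans (det-W3-σ>m j p q (σ ∸ m) m≡p+1 p+q+1≡N
                             (trans (cong (ℕ._+ (σ ∸ m)) (sym m≡p+1)) (ℕP.m+[n∸m]≡n m≤σ)) σ≤N 3≤N)
                 (formula-σ>m m i n (σ ∸ m) (ℕP.m+[n∸m]≡n m≤σ)))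
  where
  open Cyclic n i
  m p q : ℕ
  m = j ∸ n
  p = m ∸ 1
  q = N ∸ m
  m≡p+1 : m ≡ suc p
  m≡p+1 = sym (ℕP.m+[n∸m]≡n (ℕP.≤-trans (ℕP.≤-reflexive (sym (ℕP.m+n∸m≡n n 1))) (ℕP.∸-monoˡ-≤ n n+1≤j)))
  p+q+1≡N : suc (p ℕ.+ q) ≡ N
  p+q+1≡N = trans (cong (ℕ._+ q) (sym m≡p+1))
                  (ℕP.m+[n∸m]≡n (ℕP.≤-trans (ℕP.∸-monoˡ-≤ n j≤3n) (ℕP.≤-reflexive (ℕP.m+n∸m≡n n N))))
  1≤σ : 1 ≤ σ
  1≤σ = ℕP.≤-trans 1≤i (ℕP.m≤m+n i (i ℕ.+ 0))
  σ≤N : σ ≤ N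
  σ≤N = ℕP.*-monoʳ-≤ 2 i≤n
  3≤N : 3 ≤ N
  3≤N = ℕP.≤-trans (ℕP.n≤1+n 3) (ℕP.*-monoʳ-≤ 2 2≤n)
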